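{- Let $G$ be a connected graph of minimum degree $2$ and girth at least $5$. Then every vertex cover of $G$ is an MEG-set of $G$.
   Context: All graphs are finite and simple. The girth is the length of a shortest cycle. A vertex cover is a set of vertices meeting every edge. A pair of vertices $u,v$ (or any vertex set containing them) monitors an edge $e$ if $e$ lies on every shortest $u$–$v$ path. A monitoring edge-geodetic set (MEG-set) of $G$ is a set $M\subseteq V(G)$ such that every edge of $G$ is monitored by some pair of vertices of $M$. -}

module Defs where

open import Data.Nat using (ℕ; zero; suc; _≤_)
open import Data.Fin using (Fin)
open import Data.Bool using (Bool; true; false)
open import Data.List using (List; []; _∷_; length; filter)
open import Data.List.Relation.Unary.Unique.Propositional using (Unique)
open import Data.List.Relation.Unary.Linked using (Linked)
open import Data.List.Relation.Unary.All using (All)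
open import Data.List.Membership.Propositional using (_∈_)
open import Data.Fin.Subset using (Subset) renaming (_∈_ to _∈ₛ_)
open import Data.Product using (Σ; _×_; _,_; ∃)
open import Data.Sum using (_⊎_)
open import Data.Empty using (⊥)
open import Data.List using (allFin)
open import Relation.Binary.PropositionalEquality using (_≡_)
open import Relation.Nullary using (¬_)
open import Relation.Nullary.Decidable using (does)
open import Data.Bool using (T)
import Data.Maybe
import Data.List

record Graph (n : ℕ) : Set where
  field
    adj    : Fin n → Fin n → Bool
    sym    : ∀ u v → adj u v ≡ adj v u
    irrefl : ∀ u → adj u u ≡ false

module _ {n : ℕ} (G : Graph n) where
  open Graph G

  Adj : Fin n → Fin n → Set
  Adj u v = adj u v ≡ true

  data Walk : Fin n → Fin n → Set where
    nil  : ∀ {u} → Walk u u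
    cons : ∀ {u w v} → Adj u w → Walk w v → Walk u v

  len : ∀ {u v} → Walk u v → ℕ
  len nil        = 0
  len (cons _ p) = suc (len p)

  vertices : ∀ {u v} → Walk u v → List (Fin n)
  vertices {u} nil        = u ∷ []
  vertices {u} (cons _ p) = u ∷ vertices p

  IsPath : ∀ {u v} → Walk u v → Set
  IsPath p = Unique (vertices p)

  IsShortestPath : ∀ {u v} → Walk u v → Set
  IsShortestPath {u} {v} p =
    IsPath p × (∀ (q : Walk u v) → IsPath q → len p ≤ len q)

  data EdgeOn (x y : Fin n) : ∀ {u v} → Walk u v → Set where
    here  : ∀ {u w v} (a : Adj u w) (p : Walk w v) →
            (u ≡ x × w ≡ y) ⊎ (u ≡ y × w ≡ x) → EdgeOn x y (cons a p)
    there : ∀ {u w v} (a : Adj u w) (p : Walk w v) →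
            EdgeOn x y p → EdgeOn x y (cons a p)

  Monitors : Fin n → Fin n → Fin n → Fin n → Set
  Monitors u v x y = ∀ (p : Walk u v) → IsShortestPath p → EdgeOn x y p

  IsMEGSet : Subset n → Set
  IsMEGSet M = ∀ x y → Adj x y →
    Σ (Fin n) λ u → Σ (Fin n) λ v → u ∈ₛ M × v ∈ₛ M × Monitors u v x y

  IsVertexCover : Subset n → Set
  IsVertexCover M = ∀ x y → Adj x y → x ∈ₛ M ⊎ y ∈ₛ M

  Connected : Set
  Connected = ∀ u v → Walk u v

  degree : Fin n → ℕ
  degree v = length (filter (λ w → T? (adj v w)) (allFin n))
    where
      open import Data.Bool.Properties using (T?)

  MinDegree2 : Set
  MinDegree2 = (∀ v → 2 ≤ degree v) × ∃ (λ v → degree v ≡ 2)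

  -- a cycle: list v₀ … v_{k-1} with k ≥ 3 distinct vertices,
  -- consecutive ones adjacent and v_{k-1} adjacent to v₀
  record Cycle : Set where
    field
      first  : Fin n
      rest   : List (Fin n)
      long   : 2 ≤ length rest
      distinct : Unique (first ∷ rest)
      linked : Linked Adj (first ∷ rest)
      closes : Σ (Fin n) λ l → Data.List.last (first ∷ rest) ≡ Data.Maybe.just l × Adj l first
    cycleLength : ℕ
    cycleLength = suc (length rest)

  GirthAtLeast5 : Set
  GirthAtLeast5 = ∀ (c : Cycle) → 5 ≤ Cycle.cycleLength c

{-# OPTIONS --safe #-}
-- Let xy be an edge with x in the cover. If y is in the cover too, the pair x, y monitors xy,
-- the edge being the only shortest x–y path. Otherwise y has a second neighbour z, which lies
-- in the cover because y does not. Girth at least 5 leaves no triangle, so d(x, z) = 2, and no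
-- 4-cycle, so x y z is the only shortest x–z path; hence the pair x, z monitors xy.
module Submission where

open import Defs
open import Data.Nat using (ℕ; _≤_; z≤n; s≤s)
open import Data.Fin using (Fin)
open import Data.Fin.Properties using (_≟_)
open import Data.Fin.Subset using (Subset) renaming (_∈_ to _∈ₛ_)
open import Data.Fin.Subset.Properties using (_∈?_)
open import Data.Bool.Properties using (T?; T-≡)
open import Data.List using (_∷_; []; length; filter; allFin)
open import Data.List.Relation.Unary.Any using (here; there)
open import Data.List.Relation.Unary.All using ([]; _∷_)
open import Data.List.Relation.Unary.AllPairs using ([]; _∷_)
open import Data.List.Relation.Unary.Linked using ([-]; _∷_)
open import Data.List.Relation.Unary.Unique.Propositional using (Unique)
open import Data.List.Relation.Unary.Unique.Propositional.Properties using (allFin⁺; filter⁺)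
open import Data.List.Membership.Propositional.Properties using (∈-filter⁻)
open import Data.Product using (∃; ∃₂; _×_; _,_; proj₂)
open import Data.Sum using (inj₁; inj₂)
open import Data.Empty using (⊥-elim)
open import Function using (Equivalence)
open import Relation.Binary.PropositionalEquality using (_≢_; ≢-sym; refl; sym; trans)
open import Relation.Nullary using (¬_; yes; no)
open import Relation.Unary using (Pred; Decidable)

two-distinct-in-filter : ∀ {a p} {A : Set a} {P : Pred A p} (P? : Decidable P) {xs} → Unique xs →
  2 ≤ length (filter P? xs) → ∃₂ λ a b → P a × P b × a ≢ b
two-distinct-in-filter P? {xs} unique twoOrMore
  with filter P? xs | filter⁺ P? unique | (λ {v} → ∈-filter⁻ P? {v = v} {xs = xs})
two-distinct-in-filter P? unique (s≤s (s≤s _)) | a ∷ b ∷ _ | (a≢b ∷ _) ∷ _ | ∈⁻ =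
  a , b , proj₂ (∈⁻ (here refl)) , proj₂ (∈⁻ (there (here refl))) , a≢b

module _ {n : ℕ} {G : Graph n} where
  open Graph G using (adj; irrefl)

  private variable
    u v w x y z : Fin n

  adj⇒≢ : Adj G x y → x ≢ y
  adj⇒≢ {x} xy refl with () ← trans (sym xy) (irrefl x)

  adj-sym : Adj G x y → Adj G y x
  adj-sym {x} {y} xy = trans (Graph.sym G y x) xy

  EdgeOn-swap : ∀ {p : Walk G u v} → EdgeOn G x y p → EdgeOn G y x p
  EdgeOn-swap (here a p (inj₁ e)) = here a p (inj₂ e)
  EdgeOn-swap (here a p (inj₂ e)) = here a p (inj₁ e)
  EdgeOn-swap (there a p e)       = there a p (EdgeOn-swap e)

  Monitors-swap : Monitors G u v y x → Monitors G u v x y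
  Monitors-swap mon p shortest = EdgeOn-swap (mon p shortest)

  neighbour-other-than : 2 ≤ degree G v → ∀ x → ∃ λ z → Adj G v z × z ≢ x
  neighbour-other-than {v} deg x
    with two-distinct-in-filter (λ w → T? (adj v w)) (allFin⁺ n) deg
  ... | a , b , va , vb , a≢b with a ≟ x
  ...   | yes refl = b , Equivalence.to T-≡ vb , ≢-sym a≢b
  ...   | no a≢x   = a , Equivalence.to T-≡ va , a≢x

  no-triangle : GirthAtLeast5 G → Adj G x y → Adj G y z → ¬ Adj G z x
  no-triangle {x} {y} {z} girth xy yz zx with girth record
    { first = x ; rest = y ∷ z ∷ [] ; long = s≤s (s≤s z≤n)
    ; distinct = (adj⇒≢ xy ∷ adj⇒≢ (adj-sym zx) ∷ []) ∷ (adj⇒≢ yz ∷ []) ∷ [] ∷ []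
    ; linked = xy ∷ yz ∷ [-]
    ; closes = z , refl , zx }
  ... | s≤s (s≤s (s≤s ()))

  no-square : GirthAtLeast5 G → Adj G x y → Adj G y z → Adj G z w → x ≢ z → y ≢ w →
    ¬ Adj G w x
  no-square {x} {y} {z} {w} girth xy yz zw x≢z y≢w wx with girth record
    { first = x ; rest = y ∷ z ∷ w ∷ [] ; long = s≤s (s≤s z≤n)
    ; distinct = (adj⇒≢ xy ∷ x≢z ∷ adj⇒≢ (adj-sym wx) ∷ [])
               ∷ (adj⇒≢ yz ∷ y≢w ∷ []) ∷ (adj⇒≢ zw ∷ []) ∷ [] ∷ []
    ; linked = xy ∷ yz ∷ zw ∷ [-]
    ; closes = w , refl , wx }
  ... | s≤s (s≤s (s≤s (s≤s ())))

  edge-monitors-itself : Adj G x y → Monitors G x y x y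
  edge-monitors-itself xy nil _ = ⊥-elim (adj⇒≢ xy refl)
  edge-monitors-itself xy (cons xy′ nil) _ = here xy′ nil (inj₁ (refl , refl))
  edge-monitors-itself xy (cons _ (cons _ _)) (_ , shortest)
    with s≤s () ← shortest (cons xy nil) ((adj⇒≢ xy ∷ []) ∷ [] ∷ [])

  two-path-monitors-first-edge : GirthAtLeast5 G → Adj G x y → Adj G y z → x ≢ z →
    Monitors G x z x y
  two-path-monitors-first-edge girth xy yz x≢z nil _ = ⊥-elim (x≢z refl)
  two-path-monitors-first-edge girth xy yz x≢z (cons xz nil) _ =
    ⊥-elim (no-triangle girth xy yz (adj-sym xz))
  two-path-monitors-first-edge {y = y} girth xy yz x≢z (cons {w = w} xw (cons wz nil)) _
    with w ≟ y
  ... | yes refl = here xw _ (inj₁ (refl , refl))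
  ... | no w≢y   =
    ⊥-elim (no-square girth xy yz (adj-sym wz) x≢z (≢-sym w≢y) (adj-sym xw))
  two-path-monitors-first-edge girth xy yz x≢z (cons _ (cons _ (cons _ _))) (_ , shortest)
    with s≤s (s≤s ()) ← shortest (cons xy (cons yz nil))
                          ((adj⇒≢ xy ∷ x≢z ∷ []) ∷ (adj⇒≢ yz ∷ []) ∷ [] ∷ [])

  covered-endpoint-monitors : GirthAtLeast5 G → (∀ v → 2 ≤ degree G v) →
    ∀ {M} → IsVertexCover G M → Adj G x y → x ∈ₛ M →
    ∃₂ λ u v → u ∈ₛ M × v ∈ₛ M × Monitors G u v x y
  covered-endpoint-monitors {x} {y} girth deg {M} cover xy x∈M with y ∈? M
  ... | yes y∈M = x , y , x∈M , y∈M , edge-monitors-itself xy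
  ... | no y∉M with neighbour-other-than (deg y) x
  ...   | z , yz , z≢x with cover y z yz
  ...     | inj₁ y∈M = ⊥-elim (y∉M y∈M)
  ...     | inj₂ z∈M =
    x , z , x∈M , z∈M , two-path-monitors-first-edge girth xy yz (≢-sym z≢x)

mainTheorem15 : ∀ {n : ℕ} (G : Graph n) → Connected G → MinDegree2 G → GirthAtLeast5 G →
    ∀ (M : Subset n) → IsVertexCover G M → IsMEGSet G M
mainTheorem15 G _ (deg , _) girth M cover x y xy with cover x y xy
... | inj₁ x∈M = covered-endpoint-monitors girth deg cover xy x∈M
... | inj₂ y∈M with covered-endpoint-monitors girth deg cover (adj-sym {G = G} xy) y∈M
...   | u , v , u∈M , v∈M , mon = u , v , u∈M , v∈M , Monitors-swap mon
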